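{- Let $X,Y$ be finite sets, $\pi:X\to Y$ a map, and $g$ a choice function on $Y$. Define the choice function $f=\pi^*(g)$ on $X$ by $f(A)=A\cap\pi^{ -1}(g(\pi(A)))$ for $A\subseteq X$. If $g$ is a Plott function, then $f$ is a Plott function.
   Context: A choice function on a finite set $Z$ is a map $h:2^Z\to2^Z$ with $h(A)\subseteq A$ for all $A\subseteq Z$; it is a Plott function if $h(A\cup B)=h(h(A)\cup B)$ for all $A,B\subseteq Z$. -}

module Defs where

open import Data.Nat using (ℕ)
open import Data.Bool using (Bool; true; false; _∧_)
open import Data.Fin using (Fin; _≟_)
open import Data.Fin.Properties using (any?)
open import Data.Fin.Subset using (Subset; _⊆_; _∪_; _∩_; _∈_)
open import Data.Vec using (tabulate; lookup)
open import Data.Product using (_×_)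
open import Relation.Nullary using (does)
open import Relation.Nullary.Decidable using (_×-dec_)
open import Data.Fin.Subset.Properties using (_∈?_)
open import Relation.Binary.PropositionalEquality using (_≡_)

-- A finite set is modelled as Fin n; its subsets as Subset n (characteristic vectors).

IsChoiceFunction : {n : ℕ} → (Subset n → Subset n) → Set
IsChoiceFunction {n} h = (A : Subset n) → h A ⊆ A

IsPlott : {n : ℕ} → (Subset n → Subset n) → Set
IsPlott {n} h = (A B : Subset n) → h (A ∪ B) ≡ h (h A ∪ B)

image : {m n : ℕ} → (Fin m → Fin n) → Subset m → Subset n
image π A = tabulate (λ y → does (any? (λ x → (x ∈? A) ×-dec (π x ≟ y))))

preimage : {m n : ℕ} → (Fin m → Fin n) → Subset n → Subset m
preimage π C = tabulate (λ x → lookup C (π x))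

pullback : {m n : ℕ} → (Fin m → Fin n) → (Subset n → Subset n) → Subset m → Subset m
pullback π g A = A ∩ preimage π (g (image π A))

{-# OPTIONS --safe #-}
-- Pulling back commutes with images: π(π*(g)(A)) = g(π(A)), and π
-- preserves unions, so path independence of g gives
-- g(π(π*(g)(A) ∪ B)) = g(π(A) ∪ π(B)) = g(π(A ∪ B)); both sides of the Plott
-- identity for π*(g) are therefore cut out by the same preimage. What remains is
-- that an x ∈ A surviving in (A ∪ B) ∩ π⁻¹(g(π(A ∪ B))) also survives in π*(g)(A),
-- which is heritage of g: a Plott choice function satisfies g(T ∪ U) ∩ T ⊆ g(T).
module Submission where

open import Defs
open import Data.Nat using (ℕ)
open import Data.Bool using (Bool; true)
open import Data.Fin using (Fin; _≟_)
open import Data.Fin.Properties using (any?)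
open import Data.Fin.Subset using (Subset; _∈_; _⊆_; _∪_; _∩_; ∁; ⊤)
open import Data.Fin.Subset.Properties
  using (_∈?_; ⊆-antisym; p∩q⊆p; p∩q⊆q; x∈p∩q⁺; x∈p∩q⁻; x∈p∪q⁺; x∈p∪q⁻; p⊆p∪q; q⊆p∪q;
         ∪-distribˡ-∩; ∩-identityʳ; p∪∁p≡⊤; x∈p⇒x∉∁p)
open import Data.Vec using (tabulate; lookup)
open import Data.Vec.Properties using (lookup∘tabulate; []=⇒lookup; lookup⇒[]=)
open import Data.Product using (_×_; _,_; ∃-syntax)
open import Data.Sum using (inj₁; inj₂)
open import Function.Bundles using (_⇔_; mk⇔; Equivalence)
open import Relation.Nullary.Negation using (contradiction)
open import Relation.Nullary.Decidable using (Dec; yes; does; dec-true; _×-dec_)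
open import Relation.Binary.PropositionalEquality using (_≡_; refl; trans; sym; cong; subst; module ≡-Reasoning)

private
  variable
    m n : ℕ

∈-tabulate⇔ : (f : Fin n → Bool) {x : Fin n} → x ∈ tabulate f ⇔ f x ≡ true
∈-tabulate⇔ f {x} = mk⇔
  (λ x∈ → trans (sym (lookup∘tabulate f x)) ([]=⇒lookup x∈))
  (λ fx → lookup⇒[]= x (tabulate f) (trans (lookup∘tabulate f x) fx))

does-true⇒ : {P : Set} (p? : Dec P) → does p? ≡ true → P
does-true⇒ (yes p) _ = p

module _ (π : Fin m → Fin n) where

  ∈-preimage⇔ : {C : Subset n} {x : Fin m} → x ∈ preimage π C ⇔ π x ∈ C
  ∈-preimage⇔ {C} {x} = mk⇔
    (λ x∈ → lookup⇒[]= (π x) C (Equivalence.to (∈-tabulate⇔ _) x∈))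
    (λ πx∈ → Equivalence.from (∈-tabulate⇔ _) ([]=⇒lookup πx∈))

  ∈-image⁺ : {A : Subset m} {x : Fin m} → x ∈ A → π x ∈ image π A
  ∈-image⁺ {A} {x} x∈A =
    Equivalence.from (∈-tabulate⇔ _) (dec-true (any? _) (x , x∈A , refl))

  ∈-image⁻ : {A : Subset m} {y : Fin n} → y ∈ image π A → ∃[ x ] x ∈ A × π x ≡ y
  ∈-image⁻ {A} {y} y∈ = does-true⇒ (any? (λ x → (x ∈? A) ×-dec (π x ≟ y)))
    (Equivalence.to (∈-tabulate⇔ _) y∈)

  image-∪ : (A B : Subset m) → image π (A ∪ B) ≡ image π A ∪ image π B
  image-∪ A B = ⊆-antisym image-∪⊆ ∪-image⊆
    where
    image-∪⊆ : image π (A ∪ B) ⊆ image π A ∪ image π B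
    image-∪⊆ y∈ with ∈-image⁻ y∈
    ... | x , x∈A∪B , refl with x∈p∪q⁻ A B x∈A∪B
    ...   | inj₁ x∈A = x∈p∪q⁺ (inj₁ (∈-image⁺ x∈A))
    ...   | inj₂ x∈B = x∈p∪q⁺ (inj₂ (∈-image⁺ x∈B))

    ∪-image⊆ : image π A ∪ image π B ⊆ image π (A ∪ B)
    ∪-image⊆ y∈ with x∈p∪q⁻ (image π A) (image π B) y∈
    ... | inj₁ y∈πA with ∈-image⁻ y∈πA
    ...   | x , x∈A , refl = ∈-image⁺ (p⊆p∪q B x∈A)
    ∪-image⊆ y∈ | inj₂ y∈πB with ∈-image⁻ y∈πB
    ...   | x , x∈B , refl = ∈-image⁺ (q⊆p∪q A B x∈B)

  module _ {g : Subset n → Subset n} (choice : IsChoiceFunction g) where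

    image-pullback : (A : Subset m) → image π (pullback π g A) ≡ g (image π A)
    image-pullback A = ⊆-antisym image-pullback⊆ ⊆image-pullback
      where
      image-pullback⊆ : image π (pullback π g A) ⊆ g (image π A)
      image-pullback⊆ y∈ with ∈-image⁻ y∈
      ... | x , x∈fA , refl =
        Equivalence.to ∈-preimage⇔ (p∩q⊆q A _ x∈fA)

      ⊆image-pullback : g (image π A) ⊆ image π (pullback π g A)
      ⊆image-pullback y∈ with ∈-image⁻ (choice (image π A) y∈)
      ... | x , x∈A , refl = ∈-image⁺ (x∈p∩q⁺ (x∈A , Equivalence.from ∈-preimage⇔ y∈))

pullback-isChoiceFunction : (π : Fin m → Fin n) (g : Subset n → Subset n) →
                            IsChoiceFunction (pullback π g)
pullback-isChoiceFunction π g A = p∩q⊆p A _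

∪-∁-absorb : (T U : Subset n) → T ∪ (U ∩ ∁ T) ≡ T ∪ U
∪-∁-absorb T U = begin
  T ∪ (U ∩ ∁ T)          ≡⟨ ∪-distribˡ-∩ T U (∁ T) ⟩
  (T ∪ U) ∩ (T ∪ ∁ T)    ≡⟨ cong ((T ∪ U) ∩_) (p∪∁p≡⊤ T) ⟩
  (T ∪ U) ∩ ⊤            ≡⟨ ∩-identityʳ (T ∪ U) ⟩
  T ∪ U                  ∎
  where open ≡-Reasoning

module _ {g : Subset n → Subset n} (choice : IsChoiceFunction g) (plott : IsPlott g) where

  -- Path independence gives g(T ∪ U') ⊆ g(T) ∪ U'; removing T from U makes the
  -- second alternative impossible for elements of T.
  Plott⇒heritage : (T U : Subset n) {y : Fin n} → y ∈ T → y ∈ g (T ∪ U) → y ∈ g T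
  Plott⇒heritage T U {y} y∈T y∈g[T∪U] with x∈p∪q⁻ (g T) U' y∈gT∪U'
    where
    U' : Subset n
    U' = U ∩ ∁ T
    y∈gT∪U' : y ∈ g T ∪ U'
    y∈gT∪U' = choice (g T ∪ U')
      (subst (y ∈_) (trans (cong g (sym (∪-∁-absorb T U))) (plott T U')) y∈g[T∪U])
  ... | inj₁ y∈gT = y∈gT
  ... | inj₂ y∈U' with x∈p∩q⁻ U (∁ T) y∈U'
  ...   | _ , y∈∁T = contradiction y∈∁T (x∈p⇒x∉∁p y∈T)

  module _ (π : Fin m → Fin n) where

    g-image-pullback-∪ : (A B : Subset m) →
                         g (image π (pullback π g A ∪ B)) ≡ g (image π (A ∪ B))
    g-image-pullback-∪ A B = begin
      g (image π (pullback π g A ∪ B))          ≡⟨ cong g (image-∪ π (pullback π g A) B) ⟩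
      g (image π (pullback π g A) ∪ image π B)  ≡⟨ cong (λ C → g (C ∪ image π B)) (image-pullback π choice A) ⟩
      g (g (image π A) ∪ image π B)             ≡⟨ sym (plott (image π A) (image π B)) ⟩
      g (image π A ∪ image π B)                 ≡⟨ cong g (sym (image-∪ π A B)) ⟩
      g (image π (A ∪ B))                       ∎
      where open ≡-Reasoning

    pullback-isPlott : IsPlott (pullback π g)
    pullback-isPlott A B = begin
      (A ∪ B) ∩ P
        ≡⟨ ⊆-antisym ⊆pullback-side pullback-side⊆ ⟩
      (pullback π g A ∪ B) ∩ P
        ≡⟨ cong (λ C → (pullback π g A ∪ B) ∩ preimage π C) (sym (g-image-pullback-∪ A B)) ⟩
      (pullback π g A ∪ B) ∩ preimage π (g (image π (pullback π g A ∪ B)))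
        ∎
      where
      open ≡-Reasoning
      P : Subset m
      P = preimage π (g (image π (A ∪ B)))

      ⊆pullback-side : (A ∪ B) ∩ P ⊆ (pullback π g A ∪ B) ∩ P
      ⊆pullback-side {x} x∈ with x∈p∩q⁻ (A ∪ B) P x∈
      ... | x∈A∪B , x∈P with x∈p∪q⁻ A B x∈A∪B
      ...   | inj₂ x∈B = x∈p∩q⁺ (q⊆p∪q (pullback π g A) B x∈B , x∈P)
      ...   | inj₁ x∈A = x∈p∩q⁺ (p⊆p∪q B x∈fA , x∈P)
        where
        πx∈g[πA∪πB] : π x ∈ g (image π A ∪ image π B)
        πx∈g[πA∪πB] = subst (λ C → π x ∈ g C) (image-∪ π A B) (Equivalence.to (∈-preimage⇔ π) x∈P)
        x∈fA : x ∈ pullback π g A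
        x∈fA = x∈p∩q⁺ (x∈A , Equivalence.from (∈-preimage⇔ π)
                 (Plott⇒heritage (image π A) (image π B) (∈-image⁺ π x∈A) πx∈g[πA∪πB]))

      pullback-side⊆ : (pullback π g A ∪ B) ∩ P ⊆ (A ∪ B) ∩ P
      pullback-side⊆ x∈ with x∈p∩q⁻ (pullback π g A ∪ B) P x∈
      ... | x∈fA∪B , x∈P with x∈p∪q⁻ (pullback π g A) B x∈fA∪B
      ...   | inj₁ x∈fA = x∈p∩q⁺ (p⊆p∪q B (p∩q⊆p A _ x∈fA) , x∈P)
      ...   | inj₂ x∈B = x∈p∩q⁺ (q⊆p∪q A B x∈B , x∈P)

propositionC1 : (m n : ℕ) (π : Fin m → Fin n) (g : Subset n → Subset n) →
    IsChoiceFunction g → IsPlott g → IsChoiceFunction (pullback π g) × IsPlott (pullback π g)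
propositionC1 m n π g choice plott =
  pullback-isChoiceFunction π g , pullback-isPlott choice plott π
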